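{- Let $\{s_n\}_{n=1}^{\infty}$ be a strictly increasing algorithmically given sequence of rational numbers in the interval $[a,b]$ of constructive real numbers which has no constructive limit (a Specker sequence). For each $n$ let $A_n=[a,s_n)$ and $B_n=[s_n,b]$ (intervals of constructive real numbers), and put $A=\bigcup_n A_n$ and $B=\bigcap_n B_n$. Then the interval $[a,b]$ is weakly separated by $A$ and $B$. Moreover, $A$ is open, pseudo open and sequentially closed in $[a,b]$, and $B$ is closed, pseudo open and sequentially closed in $[a,b]$.
   Context: The setting is constructive mathematics in the sense of the Russian school (Markov), with Markov's principle allowed: if an element of an algorithmically enumerable set cannot fail to exist, then it can be found algorithmically. A constructive real number (CRN) is an algorithmically given Cauchy sequence of rationals together with an algorithm regulating its convergence; two CRNs are equal if the terms of their sequences with sufficiently large indices are arbitrarily close. For a point $x$ and natural $n$, $B(x,n)$ is the open ball of radius $2^{ -n}$ centred at $x$. For a set $S$ of points of a constructive metric space $X$: $S$ is open in $X$ if there is an algorithm $G$ assigning to each $s\in S$ a natural number $G(s)$ with $B(s,G(s))\subseteq S$; $S$ is pseudo open if for every $s\in S$ it is impossible that there is no natural number $n$ with $B(s,n)\subseteq S$; $S$ is closed if it is the complement of an open set; $S$ is sequentially closed if whenever an algorithmically given sequence of points of $S$ converges constructively to a limit, the limit lies in $S$. A subset is suitable if, together with any point, it contains all points equal to it. Two nonempty disjoint suitable subsets $A,B$ of $X$ weakly separate $X$ if the statement that a point of $X$ does not belong to one of them implies that it belongs to the other. -}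

module Defs where

open import Data.Nat as ℕ using (ℕ; zero; suc)
open import Data.Rational as ℚ using (ℚ; ½; 1ℚ; ∣_∣)
open import Data.Product using (Σ; ∃; ∃-syntax; _×_; _,_; proj₁)
open import Data.Bool using (Bool; true)
open import Relation.Binary.PropositionalEquality using (_≡_)
open import Relation.Nullary using (¬_)

ε : ℕ → ℚ
ε zero = 1ℚ
ε (suc k) = ½ ℚ.* ε k

Seq : Set
Seq = ℕ → ℚ

const : ℚ → Seq
const q _ = q

record CRN : Set where
  constructor mkCRN
  field
    seq     : Seq
    modulus : ℕ → ℕ
    cauchy  : ∀ k m n → modulus k ℕ.≤ m → modulus k ℕ.≤ n →
              ∣ seq m ℚ.- seq n ∣ ℚ.≤ ε k
open CRN public

_≈ˢ_ : Seq → Seq → Set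
x ≈ˢ y = ∀ k → ∃[ N ] ∀ n → N ℕ.≤ n → ∣ x n ℚ.- y n ∣ ℚ.≤ ε k

_<ˢ_ : Seq → Seq → Set
x <ˢ y = ∃[ k ] ∃[ N ] ∀ n → N ℕ.≤ n → x n ℚ.+ ε k ℚ.≤ y n

_≤ˢ_ : Seq → Seq → Set
x ≤ˢ y = ¬ (y <ˢ x)

dist : Seq → Seq → Seq
dist x y n = ∣ x n ℚ.- y n ∣

_≈ᴿ_ : CRN → CRN → Set
x ≈ᴿ y = seq x ≈ˢ seq y

_<ᴿ_ : CRN → CRN → Set
x <ᴿ y = seq x <ˢ seq y

_≤ᴿ_ : CRN → CRN → Set
x ≤ᴿ y = seq x ≤ˢ seq y

_≤q_ : CRN → ℚ → Set
x ≤q q = seq x ≤ˢ const q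

_<q_ : CRN → ℚ → Set
x <q q = seq x <ˢ const q

_q≤_ : ℚ → CRN → Set
q q≤ x = const q ≤ˢ seq x

MarkovPrinciple : Set
MarkovPrinciple = (P : ℕ → Bool) → ¬ ¬ (∃[ n ] P n ≡ true) → ∃[ n ] P n ≡ true

ConvergesTo : (ℕ → CRN) → CRN → Set
ConvergesTo f x = Σ (ℕ → ℕ) λ M → ∀ k n → M k ℕ.≤ n →
  dist (seq (f n)) (seq x) ≤ˢ const (ε k)

RatConvergesTo : (ℕ → ℚ) → CRN → Set
RatConvergesTo s x = Σ (ℕ → ℕ) λ M → ∀ k n → M k ℕ.≤ n →
  dist (const (s n)) (seq x) ≤ˢ const (ε k)

module Interval (a b : CRN) where

  Point : Set
  Point = Σ CRN λ x → (a ≤ᴿ x) × (x ≤ᴿ b)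

  pt : Point → CRN
  pt = proj₁

  Subset : Set₁
  Subset = Point → Set

  _≈_ : Point → Point → Set
  x ≈ y = pt x ≈ᴿ pt y

  Ball : Point → ℕ → Subset
  Ball x n y = dist (seq (pt x)) (seq (pt y)) <ˢ const (ε n)

  _⊆_ : Subset → Subset → Set
  S ⊆ T = ∀ x → S x → T x

  Complement : Subset → Subset
  Complement S x = ¬ S x

  IsOpen : Subset → Set
  IsOpen S = Σ ((s : Point) → S s → ℕ) λ G → ∀ s (h : S s) → Ball s (G s h) ⊆ S

  IsPseudoOpen : Subset → Set
  IsPseudoOpen S = ∀ s → S s → ¬ ¬ (∃[ n ] Ball s n ⊆ S)

  IsClosed : Subset → Set₁
  IsClosed S = Σ Subset λ U → IsOpen U × (∀ x → (S x → Complement U x) × (Complement U x → S x))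

  SeqConverges : (ℕ → Point) → Point → Set
  SeqConverges f x = ConvergesTo (λ n → pt (f n)) (pt x)

  IsSequentiallyClosed : Subset → Set
  IsSequentiallyClosed S = ∀ (f : ℕ → Point) (x : Point) →
    (∀ n → S (f n)) → SeqConverges f x → S x

  IsSuitable : Subset → Set
  IsSuitable S = ∀ x y → x ≈ y → S x → S y

  WeaklySeparate : Subset → Subset → Set
  WeaklySeparate A B =
    (∃[ x ] A x) × (∃[ x ] B x) ×
    (∀ x → ¬ (A x × B x)) ×
    IsSuitable A × IsSuitable B ×
    (∀ x → (¬ A x → B x) × (¬ B x → A x))

IsSpecker : (a b : CRN) → (ℕ → ℚ) → Set
IsSpecker a b s =
  (∀ n → s n ℚ.< s (suc n)) ×
  (∀ n → (a ≤q s n) × (s n q≤ b)) ×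
  ¬ (Σ CRN λ x → RatConvergesTo s x)

module SpeckerSets (a b : CRN) (s : ℕ → ℚ) where
  open Interval a b

  Aₙ : ℕ → Subset
  Aₙ n x = (a ≤ᴿ pt x) × (pt x <q s n)

  Bₙ : ℕ → Subset
  Bₙ n x = (s n q≤ pt x) × (pt x ≤ᴿ b)

  A : Subset
  A x = ∃[ n ] Aₙ n x

  B : Subset
  B x = ∀ n → Bₙ n x

-- Markov's principle turns ¬ (x ∈ B) into
-- an explicit n with x < s n, because x < q can be read off from a decidable
-- comparison of a single rational approximation of x with q. The remaining
-- properties are all proved against the Specker property: a sequence in A
-- converging to a point x of B, or a point x of B no ball around which lies in
-- B, would force s to converge to x, since s increases and stays below x.
module Submission where

open import Defs
open import Data.Bool.Properties using (T-≡)
open import Data.Empty using (⊥-elim)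
open import Data.Integer as ℤ using (+_; +[1+_]; -[1+_])
open import Data.Nat as ℕ using (ℕ; zero; suc; _⊔_; z≤n; s≤s)
import Data.Nat.Properties as ℕₚ
open import Data.Nat.Coprimality using (1-coprimeTo)
open import Data.Nat.Tactic.RingSolver using (solve-∀)
open import Data.Product using (Σ; ∃; ∃-syntax; _×_; _,_; proj₁; proj₂)
open import Data.Rational as ℚ using (ℚ; mkℚ; ½; 0ℚ; ∣_∣; _+_; _*_; _-_; -_; _≤_; _<_)
import Data.Rational.Properties as ℚₚ
open import Data.Rational.Solver using (module +-*-Solver)
import Data.Rational.Unnormalised as ℚᵘ
import Data.Rational.Unnormalised.Properties as ℚᵘₚ
open import Data.Sum using (inj₁; inj₂)
open import Function using (_∘_)
open import Function.Bundles using (module Equivalence)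
open import Relation.Binary.PropositionalEquality
import Relation.Binary.Reasoning.Base.Single as SingleReasoning
open import Relation.Binary.Reasoning.Syntax using (module ⊑-syntax)
open import Relation.Nullary using (¬_; Dec; yes; no)
open import Relation.Nullary.Decidable using (isYes; toWitness; fromWitness)

open +-*-Solver

-- Rational arithmetic

+-cancelʳ-≤ : ∀ r {p q} → p + r ≤ q + r → p ≤ q
+-cancelʳ-≤ r {p} {q} p+r≤q+r = begin
  p          ≡⟨ p+r-r≡p p ⟨
  p + r - r  ≤⟨ ℚₚ.+-monoˡ-≤ (- r) p+r≤q+r ⟩
  q + r - r  ≡⟨ p+r-r≡p q ⟩
  q          ∎
  where
  open ℚₚ.≤-Reasoning
  p+r-r≡p : ∀ p → p + r - r ≡ p
  p+r-r≡p p = solve 2 (λ p r → p :+ r :- r := p) refl p r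

-- p ≤ q follows from l ≤ r whenever p - q = l - r; the identity is left to the ring solver.
≤-rearrange : ∀ {p q l r} → p + r ≡ q + l → l ≤ r → p ≤ q
≤-rearrange {p} {q} {l} {r} eq l≤r = +-cancelʳ-≤ r (begin
  p + r  ≡⟨ eq ⟩
  q + l  ≤⟨ ℚₚ.+-monoʳ-≤ q l≤r ⟩
  q + r  ∎)
  where open ℚₚ.≤-Reasoning

p≤p+q : ∀ p {q} → 0ℚ ≤ q → p ≤ p + q
p≤p+q p {q} 0≤q = begin
  p       ≡⟨ ℚₚ.+-identityʳ p ⟨
  p + 0ℚ  ≤⟨ ℚₚ.+-monoʳ-≤ p 0≤q ⟩
  p + q   ∎
  where open ℚₚ.≤-Reasoning

p≤∣p∣ : ∀ p → p ≤ ∣ p ∣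
p≤∣p∣ p with 0ℚ ℚₚ.≤? p
... | yes 0≤p = ℚₚ.≤-reflexive (sym (ℚₚ.0≤p⇒∣p∣≡p 0≤p))
... | no  0≰p = ℚₚ.≤-trans (ℚₚ.<⇒≤ (ℚₚ.≰⇒> 0≰p)) (ℚₚ.0≤∣p∣ p)

-p≤∣p∣ : ∀ p → - p ≤ ∣ p ∣
-p≤∣p∣ p = subst (- p ≤_) (ℚₚ.∣-p∣≡∣p∣ p) (p≤∣p∣ (- p))

∣p-q∣≡∣q-p∣ : ∀ p q → ∣ p - q ∣ ≡ ∣ q - p ∣
∣p-q∣≡∣q-p∣ p q = trans (sym (ℚₚ.∣-p∣≡∣p∣ (p - q)))
                        (cong ∣_∣ (solve 2 (λ p q → :- (p :- q) := q :- p) refl p q))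

∣p-q∣≤r⇒p≤q+r : ∀ p q {r} → ∣ p - q ∣ ≤ r → p ≤ q + r
∣p-q∣≤r⇒p≤q+r p q {r} ∣p-q∣≤r = ≤-rearrange
  (solve 3 (λ p q r → p :+ r := q :+ r :+ (p :- q)) refl p q r)
  (ℚₚ.≤-trans (p≤∣p∣ (p - q)) ∣p-q∣≤r)

∣p-q∣≤r⇒q≤p+r : ∀ p q {r} → ∣ p - q ∣ ≤ r → q ≤ p + r
∣p-q∣≤r⇒q≤p+r p q {r} ∣p-q∣≤r = ≤-rearrange
  (solve 3 (λ p q r → q :+ r := p :+ r :+ (:- (p :- q))) refl p q r)
  (ℚₚ.≤-trans (-p≤∣p∣ (p - q)) ∣p-q∣≤r)

p≤q+r∧q≤p+r⇒∣p-q∣≤r : ∀ {p q r} → p ≤ q + r → q ≤ p + r → ∣ p - q ∣ ≤ r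
p≤q+r∧q≤p+r⇒∣p-q∣≤r {p} {q} {r} p≤q+r q≤p+r with ℚₚ.∣p∣≡p∨∣p∣≡-p (p - q)
... | inj₁ ∣p-q∣≡p-q = subst (_≤ r) (sym ∣p-q∣≡p-q)
  (≤-rearrange (solve 3 (λ p q r → p :- q :+ (q :+ r) := r :+ p) refl p q r) p≤q+r)
... | inj₂ ∣p-q∣≡q-p = subst (_≤ r) (sym ∣p-q∣≡q-p)
  (≤-rearrange (solve 3 (λ p q r → :- (p :- q) :+ (p :+ r) := r :+ q) refl p q r) q≤p+r)

∣∣p∣-∣q∣∣≤∣p-q∣ : ∀ p q → ∣ ∣ p ∣ - ∣ q ∣ ∣ ≤ ∣ p - q ∣
∣∣p∣-∣q∣∣≤∣p-q∣ p q = p≤q+r∧q≤p+r⇒∣p-q∣≤r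
  (∣p∣≤∣q∣+∣p-q∣ p q) (subst (λ d → ∣ q ∣ ≤ ∣ p ∣ + d) (∣p-q∣≡∣q-p∣ q p) (∣p∣≤∣q∣+∣p-q∣ q p))
  where
  ∣p∣≤∣q∣+∣p-q∣ : ∀ p q → ∣ p ∣ ≤ ∣ q ∣ + ∣ p - q ∣
  ∣p∣≤∣q∣+∣p-q∣ p q = subst (λ t → ∣ t ∣ ≤ ∣ q ∣ + ∣ p - q ∣)
    (solve 2 (λ p q → q :+ (p :- q) := p) refl p q) (ℚₚ.∣p+q∣≤∣p∣+∣q∣ q (p - q))

ε-half : ∀ k → ε (suc k) + ε (suc k) ≡ ε k
ε-half k = solve 1 (λ e → con ½ :* e :+ con ½ :* e := e) refl (ε k)

p+ε′+ε′≡p+ε : ∀ p k → p + ε (suc k) + ε (suc k) ≡ p + ε k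
p+ε′+ε′≡p+ε p k = trans (ℚₚ.+-assoc p _ _) (cong (_+_ p) (ε-half k))

ε-pos : ∀ k → 0ℚ < ε k
ε-pos zero    = ℚₚ.positive⁻¹ (ε zero)
ε-pos (suc k) = subst (_< ε (suc k)) (ℚₚ.*-zeroʳ ½) (ℚₚ.*-monoʳ-<-pos ½ (ε-pos k))

ε-nonneg : ∀ k → 0ℚ ≤ ε k
ε-nonneg k = ℚₚ.<⇒≤ (ε-pos k)

ε-suc< : ∀ k → ε (suc k) < ε k
ε-suc< k = begin-strict
  ε (suc k)              ≡⟨ ℚₚ.+-identityʳ (ε (suc k)) ⟨
  ε (suc k) + 0ℚ         <⟨ ℚₚ.+-monoʳ-< (ε (suc k)) (ε-pos (suc k)) ⟩
  ε (suc k) + ε (suc k)  ≡⟨ ε-half k ⟩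
  ε k                    ∎
  where open ℚₚ.≤-Reasoning

ε-antitone : ∀ {j k} → j ℕ.≤ k → ε k ≤ ε j
ε-antitone j≤k = antitone′ (ℕₚ.≤⇒≤′ j≤k)
  where
  antitone′ : ∀ {j k} → j ℕ.≤′ k → ε k ≤ ε j
  antitone′ ℕ.≤′-refl            = ℚₚ.≤-refl
  antitone′ (ℕ.≤′-step {k} j≤′k) = ℚₚ.≤-trans (ℚₚ.<⇒≤ (ε-suc< k)) (antitone′ j≤′k)

ε-suc+ε≤ε : ∀ {k j} → k ℕ.< j → ε (suc j) + ε j ≤ ε k
ε-suc+ε≤ε {k} {suc j} (s≤s k≤j) = begin
  ε (2 ℕ.+ j) + ε (suc j)  ≤⟨ ℚₚ.+-monoˡ-≤ (ε (suc j)) (ℚₚ.<⇒≤ (ε-suc< (suc j))) ⟩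
  ε (suc j) + ε (suc j)    ≡⟨ ε-half j ⟩
  ε j                      ≤⟨ ε-antitone k≤j ⟩
  ε k                      ∎
  where open ℚₚ.≤-Reasoning

1/[1+_] : ℕ → ℚ
1/[1+ m ] = mkℚ (+ 1) m (1-coprimeTo (suc m))

½*1/[1+m]≤1/[2+m] : ∀ m → ½ * 1/[1+ m ] ≤ 1/[1+ suc m ]
½*1/[1+m]≤1/[2+m] m = ℚₚ.toℚᵘ-cancel-≤
  (ℚᵘₚ.≤-respˡ-≃ (ℚᵘₚ.≃-sym (ℚₚ.toℚᵘ-homo-* ½ 1/[1+ m ])) (ℚᵘ.*≤* (ℤ.+≤+ 2+m≤2+2m)))
  where
  -- the cross-multiplied numerators, in the normal form of ℚᵘ multiplication
  2+m≤2+2m : 2 ℕ.+ m ℕ.+ 0 ℕ.* (2 ℕ.+ m) ℕ.≤ 1 ℕ.+ (m ℕ.+ 1 ℕ.* suc m ℕ.+ 0 ℕ.* suc (m ℕ.+ 1 ℕ.* suc m))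
  2+m≤2+2m = subst₂ ℕ._≤_ (lhs m) (rhs m) (ℕₚ.m≤n+m (2 ℕ.+ m) m)
    where
    lhs : ∀ m → 2 ℕ.+ m ≡ 2 ℕ.+ m ℕ.+ 0 ℕ.* (2 ℕ.+ m)
    lhs = solve-∀
    rhs : ∀ m → m ℕ.+ (2 ℕ.+ m) ≡ 1 ℕ.+ (m ℕ.+ 1 ℕ.* suc m ℕ.+ 0 ℕ.* suc (m ℕ.+ 1 ℕ.* suc m))
    rhs = solve-∀

ε≤1/[1+_] : ∀ m → ε m ≤ 1/[1+ m ]
ε≤1/[1+ zero ]  = ℚₚ.≤-refl
ε≤1/[1+ suc m ] = ℚₚ.≤-trans (ℚₚ.*-monoˡ-≤-nonNeg ½ (ε≤1/[1+ m ])) (½*1/[1+m]≤1/[2+m] m)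

ε-archimedean : ∀ {d} → 0ℚ < d → ∃ λ k → ε k ≤ d
ε-archimedean {mkℚ +[1+ n ] m _} _ =
  m , ℚₚ.≤-trans (ε≤1/[1+ m ]) (ℚ.*≤* (ℤ.+≤+ (s≤s (ℕₚ.+-monoʳ-≤ m z≤n))))
ε-archimedean {mkℚ (+ 0) _ _} (ℚ.*<* (ℤ.+<+ ()))
ε-archimedean {mkℚ -[1+ _ ] _ _} (ℚ.*<* ())

-- Sequences of rationals

Eventually : (ℕ → Set) → Set
Eventually P = ∃[ N ] ∀ n → N ℕ.≤ n → P n

private variable
  P Q R : ℕ → Set

always : (∀ n → P n) → Eventually P
always p = 0 , λ n _ → p n

eventually-≥ : ∀ N → Eventually (N ℕ.≤_)
eventually-≥ N = N , λ _ N≤n → N≤n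

eventually-map : (∀ {n} → P n → Q n) → Eventually P → Eventually Q
eventually-map f (N , p) = N , λ n N≤n → f (p n N≤n)

eventually-zipWith : (∀ {n} → P n → Q n → R n) → Eventually P → Eventually Q → Eventually R
eventually-zipWith f (M , p) (N , q) =
  M ⊔ N , λ n M⊔N≤n → f (p n (ℕₚ.m⊔n≤o⇒m≤o M N M⊔N≤n)) (q n (ℕₚ.m⊔n≤o⇒n≤o M N M⊔N≤n))

eventually-witness : Eventually P → ∃ P
eventually-witness (N , p) = N , p N ℕₚ.≤-refl

infixl 6 _+ᶜ_
infix  4 _⊑_

_+ᶜ_ : Seq → ℚ → Seq
(u +ᶜ e) n = u n + e

-- On Cauchy sequences ⊑ agrees with ≤ˢ (⊑⇒≤ˢ, ≤ᴿ⇒⊑), but unlike the negative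
-- statement ≤ˢ it can be chained and shifted directly.
record _⊑_ (u v : Seq) : Set where
  constructor ⊑-intro
  field ⊑-bound : ∀ j → Eventually (λ n → u n ≤ v n + ε j)
open _⊑_

eventually-≤⇒⊑ : ∀ {u v} → Eventually (λ n → u n ≤ v n) → u ⊑ v
eventually-≤⇒⊑ u≤v = ⊑-intro λ j → eventually-map (λ h → ℚₚ.≤-trans h (p≤p+q _ (ε-nonneg j))) u≤v

⊑-refl : ∀ {u} → u ⊑ u
⊑-refl = eventually-≤⇒⊑ (always λ _ → ℚₚ.≤-refl)

⊑-trans : ∀ {u v w} → u ⊑ v → v ⊑ w → u ⊑ w
⊑-trans {u} {v} {w} u⊑v v⊑w = ⊑-intro λ j →
  eventually-zipWith (step j) (⊑-bound u⊑v (suc j)) (⊑-bound v⊑w (suc j))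
  where
  open ℚₚ.≤-Reasoning
  step : ∀ j {n} → u n ≤ v n + ε (suc j) → v n ≤ w n + ε (suc j) → u n ≤ w n + ε j
  step j {n} u≤v v≤w = begin
    u n                              ≤⟨ u≤v ⟩
    v n + ε (suc j)                  ≤⟨ ℚₚ.+-monoˡ-≤ (ε (suc j)) v≤w ⟩
    w n + ε (suc j) + ε (suc j)      ≡⟨ p+ε′+ε′≡p+ε (w n) j ⟩
    w n + ε j                        ∎

module ⊑-Reasoning where
  open SingleReasoning _⊑_ ⊑-refl ⊑-trans public hiding (step-∼)
  open ⊑-syntax _IsRelatedTo_ _IsRelatedTo_ ∼-go public

⊑-shift : ∀ {u v} e → u ⊑ v → u +ᶜ e ⊑ v +ᶜ e
⊑-shift {u} {v} e u⊑v = ⊑-intro λ j → eventually-map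
  (λ {n} → ≤-rearrange (solve 4 (λ u v e d → u :+ e :+ (v :+ d) := v :+ e :+ d :+ u) refl (u n) (v n) e (ε j)))
  (⊑-bound u⊑v j)

⊑-cancel : ∀ {u v} e → u +ᶜ e ⊑ v +ᶜ e → u ⊑ v
⊑-cancel {u} {v} e u+e⊑v+e = ⊑-intro λ j → eventually-map
  (λ {n} → ≤-rearrange (solve 4 (λ u v e d → u :+ (v :+ e :+ d) := v :+ d :+ (u :+ e)) refl (u n) (v n) e (ε j)))
  (⊑-bound u+e⊑v+e j)

⊑-+ᶜ : ∀ {u e} → 0ℚ ≤ e → u ⊑ u +ᶜ e
⊑-+ᶜ {u} 0≤e = eventually-≤⇒⊑ (always λ n → p≤p+q (u n) 0≤e)

⊑-+ε⇒⊑ : ∀ {u v} → (∀ k → u ⊑ v +ᶜ ε k) → u ⊑ v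
⊑-+ε⇒⊑ {u} {v} u⊑v+ε = ⊑-intro λ j → eventually-map
  (λ {n} → subst (u n ≤_) (p+ε′+ε′≡p+ε (v n) j))
  (⊑-bound (u⊑v+ε (suc j)) (suc j))

const-⊑ : ∀ {p q} → p ≤ q → const p ⊑ const q
const-⊑ p≤q = eventually-≤⇒⊑ (always λ _ → p≤q)

⊑⇒≤ˢ : ∀ {u v} → u ⊑ v → u ≤ˢ v
⊑⇒≤ˢ {u} {v} u⊑v (k , v+ε≤u) = ℚₚ.<-irrefl refl (ℚₚ.≤-<-trans εk≤εk+1 (ε-suc< k))
  where
  εk≤εk+1 : ε k ≤ ε (suc k)
  εk≤εk+1 =
    let n , v+εk≤u , u≤v+εk+1 = eventually-witness (eventually-zipWith _,_ v+ε≤u (⊑-bound u⊑v (suc k)))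
    in ≤-rearrange (solve 3 (λ v a b → a :+ (v :+ b) := b :+ (v :+ a)) refl (v n) (ε k) (ε (suc k)))
                   (ℚₚ.≤-trans v+εk≤u u≤v+εk+1)

<ˢ-margin : ∀ {u v} (u<v : u <ˢ v) → u +ᶜ ε (proj₁ u<v) ⊑ v
<ˢ-margin {u} (k , u+ε≤v) = eventually-≤⇒⊑ {u +ᶜ ε k} u+ε≤v

<ˢ⇒⊑ : ∀ {u v} → u <ˢ v → u ⊑ v
<ˢ⇒⊑ {u} u<v@(k , _) = ⊑-trans (⊑-+ᶜ {u} (ε-nonneg k)) (<ˢ-margin {u} u<v)

+ε⊑⇒<ˢ : ∀ {u v k} → u +ᶜ ε k ⊑ v → u <ˢ v
+ε⊑⇒<ˢ {u} {v} {k} u+ε⊑v = suc k , eventually-map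
  (λ {n} → ≤-rearrange
    (solve 3 (λ u v e → u :+ con ½ :* e :+ (v :+ con ½ :* e) := v :+ (u :+ e)) refl (u n) (v n) (ε k)))
  (⊑-bound u+ε⊑v (suc k))

dist⊑⇒⊑ : ∀ {u v e} → dist u v ⊑ const e → u ⊑ v +ᶜ e × v ⊑ u +ᶜ e
dist⊑⇒⊑ {u} {v} {e} d⊑e =
  ⊑-intro (λ j → eventually-map
    (λ {n} h → subst (u n ≤_) (sym (ℚₚ.+-assoc (v n) e (ε j))) (∣p-q∣≤r⇒p≤q+r (u n) (v n) h)) (⊑-bound d⊑e j)) ,
  ⊑-intro (λ j → eventually-map
    (λ {n} h → subst (v n ≤_) (sym (ℚₚ.+-assoc (u n) e (ε j))) (∣p-q∣≤r⇒q≤p+r (u n) (v n) h)) (⊑-bound d⊑e j))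

⊑⇒dist⊑ : ∀ {u v e} → u ⊑ v +ᶜ e → v ⊑ u +ᶜ e → dist u v ⊑ const e
⊑⇒dist⊑ {u} {v} {e} u⊑v+e v⊑u+e = ⊑-intro λ j → eventually-zipWith
  (λ {n} u≤ v≤ → p≤q+r∧q≤p+r⇒∣p-q∣≤r (subst (u n ≤_) (ℚₚ.+-assoc (v n) e (ε j)) u≤)
                                    (subst (v n ≤_) (ℚₚ.+-assoc (u n) e (ε j)) v≤))
  (⊑-bound u⊑v+e j) (⊑-bound v⊑u+e j)

≈ˢ⇒⊒ : ∀ {u v} → u ≈ˢ v → v ⊑ u
≈ˢ⇒⊒ {u} {v} u≈v = ⊑-intro λ j → eventually-map (λ {n} → ∣p-q∣≤r⇒q≤p+r (u n) (v n)) (u≈v j)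

<ˢ-const-resp-⊑ : ∀ {u v q} (u<q : u <ˢ const q) → v ⊑ u +ᶜ ε (suc (proj₁ u<q)) → v <ˢ const q
<ˢ-const-resp-⊑ {u} {v} {q} u<q@(k , _) v⊑u+ε = +ε⊑⇒<ˢ {v} {const q} {suc k} (begin
  v +ᶜ ε (suc k)                  ⊑⟨ ⊑-shift (ε (suc k)) v⊑u+ε ⟩
  u +ᶜ ε (suc k) +ᶜ ε (suc k)     ⊑⟨ eventually-≤⇒⊑ (always λ n → ℚₚ.≤-reflexive (p+ε′+ε′≡p+ε (u n) k)) ⟩
  u +ᶜ ε k                        ⊑⟨ <ˢ-margin {u} u<q ⟩
  const q                         ∎)
  where open ⊑-Reasoning

-- Constructive reals

constᴿ : ℚ → CRN
constᴿ q = mkCRN (const q) (λ _ → 0)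
  (λ k _ _ _ _ → subst (λ d → ∣ d ∣ ≤ ε k) (sym (ℚₚ.+-inverseʳ q)) (ε-nonneg k))

distᴿ : CRN → CRN → CRN
distᴿ x y = mkCRN (dist (seq x) (seq y)) (λ k → modulus x (suc k) ⊔ modulus y (suc k)) dist-cauchy
  where
  open ℚₚ.≤-Reasoning
  dist-cauchy : ∀ k m n → modulus x (suc k) ⊔ modulus y (suc k) ℕ.≤ m →
                modulus x (suc k) ⊔ modulus y (suc k) ℕ.≤ n →
                ∣ dist (seq x) (seq y) m - dist (seq x) (seq y) n ∣ ≤ ε k
  dist-cauchy k m n M≤m M≤n = begin
    ∣ ∣ xm - ym ∣ - ∣ xn - yn ∣ ∣     ≤⟨ ∣∣p∣-∣q∣∣≤∣p-q∣ (xm - ym) (xn - yn) ⟩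
    ∣ (xm - ym) - (xn - yn) ∣         ≡⟨ cong ∣_∣ (solve 4 (λ a b c d → a :- b :- (c :- d) := a :- c :- (b :- d))
                                                           refl xm ym xn yn) ⟩
    ∣ (xm - xn) - (ym - yn) ∣         ≤⟨ ℚₚ.∣p-q∣≤∣p∣+∣q∣ (xm - xn) (ym - yn) ⟩
    ∣ xm - xn ∣ + ∣ ym - yn ∣         ≤⟨ ℚₚ.+-mono-≤
                                          (cauchy x (suc k) m n (ℕₚ.m⊔n≤o⇒m≤o _ _ M≤m) (ℕₚ.m⊔n≤o⇒m≤o _ _ M≤n))
                                          (cauchy y (suc k) m n (ℕₚ.m⊔n≤o⇒n≤o _ _ M≤m) (ℕₚ.m⊔n≤o⇒n≤o _ _ M≤n)) ⟩
    ε (suc k) + ε (suc k)             ≡⟨ ε-half k ⟩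
    ε k                               ∎
    where
    xm = seq x m ; ym = seq y m ; xn = seq x n ; yn = seq y n

cauchy-⊑ : ∀ x {j m} → modulus x j ℕ.≤ m →
           seq x ⊑ const (seq x m) +ᶜ ε j × const (seq x m) ⊑ seq x +ᶜ ε j
cauchy-⊑ x {j} {m} M≤m =
  eventually-≤⇒⊑ {seq x} {const (seq x m) +ᶜ ε j}
    (eventually-map (λ {n} → ∣p-q∣≤r⇒p≤q+r (seq x n) (seq x m)) close) ,
  eventually-≤⇒⊑ {const (seq x m)} {seq x +ᶜ ε j}
    (eventually-map (λ {n} → ∣p-q∣≤r⇒q≤p+r (seq x n) (seq x m)) close)
  where
  close : Eventually (λ n → ∣ seq x n - seq x m ∣ ≤ ε j)
  close = modulus x j , λ n M≤n → cauchy x j n m M≤n M≤m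

≈ᴿ-sym : ∀ x y → x ≈ᴿ y → y ≈ᴿ x
≈ᴿ-sym x y x≈y k = eventually-map (λ {n} → subst (_≤ ε k) (∣p-q∣≡∣q-p∣ (seq x n) (seq y n))) (x≈y k)

<ᴿ-at : ∀ x y k {m} → modulus x (2 ℕ.+ k) ℕ.≤ m → modulus y (2 ℕ.+ k) ℕ.≤ m →
        seq x m + ε k ≤ seq y m → x <ᴿ y
<ᴿ-at x y k {m} Mx≤m My≤m xm+ε≤ym = +ε⊑⇒<ˢ {seq x} {seq y} {suc k} (⊑-cancel (ε (2 ℕ.+ k)) (begin
  seq x +ᶜ ε (suc k) +ᶜ ε (2 ℕ.+ k)
    ⊑⟨ ⊑-shift _ (⊑-shift _ (proj₁ (cauchy-⊑ x Mx≤m))) ⟩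
  const (seq x m + ε (2 ℕ.+ k) + ε (suc k) + ε (2 ℕ.+ k))
    ⊑⟨ const-⊑ (ℚₚ.≤-trans (ℚₚ.≤-reflexive quarter+half+quarter) xm+ε≤ym) ⟩
  const (seq y m)
    ⊑⟨ proj₂ (cauchy-⊑ y My≤m) ⟩
  seq y +ᶜ ε (2 ℕ.+ k)
    ∎))
  where
  open ⊑-Reasoning
  quarter+half+quarter : seq x m + ε (2 ℕ.+ k) + ε (suc k) + ε (2 ℕ.+ k) ≡ seq x m + ε k
  quarter+half+quarter = solve 2
    (λ a e → a :+ con ½ :* (con ½ :* e) :+ con ½ :* e :+ con ½ :* (con ½ :* e) := a :+ e) refl (seq x m) (ε k)

≤ᴿ⇒⊑ : ∀ x y → x ≤ᴿ y → seq x ⊑ seq y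
≤ᴿ⇒⊑ x y x≤y = ⊑-intro λ j → eventually-map (bound j) (eventually-≥ (modulus x (2 ℕ.+ j) ⊔ modulus y (2 ℕ.+ j)))
  where
  bound : ∀ j {n} → modulus x (2 ℕ.+ j) ⊔ modulus y (2 ℕ.+ j) ℕ.≤ n → seq x n ≤ seq y n + ε j
  bound j {n} M≤n with seq x n ℚₚ.≤? seq y n + ε j
  ... | yes x≤y+ε = x≤y+ε
  ... | no  x≰y+ε = ⊥-elim (x≤y (<ᴿ-at y x j (ℕₚ.m⊔n≤o⇒n≤o _ _ M≤n) (ℕₚ.m⊔n≤o⇒m≤o _ _ M≤n)
                                      (ℚₚ.<⇒≤ (ℚₚ.≰⇒> x≰y+ε))))

≤ᴿ-refl : ∀ x → x ≤ᴿ x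
≤ᴿ-refl x = ⊑⇒≤ˢ {seq x} ⊑-refl

≤ᴿ-trans : ∀ x y z → x ≤ᴿ y → y ≤ᴿ z → x ≤ᴿ z
≤ᴿ-trans x y z x≤y y≤z = ⊑⇒≤ˢ (⊑-trans (≤ᴿ⇒⊑ x y x≤y) (≤ᴿ⇒⊑ y z y≤z))

dist≤ˢ⇒⊑ : ∀ x y {e} → dist (seq x) (seq y) ≤ˢ const e → seq x ⊑ seq y +ᶜ e × seq y ⊑ seq x +ᶜ e
dist≤ˢ⇒⊑ x y {e} d≤e = dist⊑⇒⊑ (≤ᴿ⇒⊑ (distᴿ x y) (constᴿ e) d≤e)

dist-const≤ˢ : ∀ x {q e} → 0ℚ ≤ e → q q≤ x → seq x ⊑ const (q + e) → dist (const q) (seq x) ≤ˢ const e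
dist-const≤ˢ x {q} 0≤e q≤x x⊑q+e =
  ⊑⇒≤ˢ (⊑⇒dist⊑ (⊑-trans (≤ᴿ⇒⊑ (constᴿ q) x q≤x) (⊑-+ᶜ {seq x} 0≤e)) x⊑q+e)

<q-resp-≈ᴿ : ∀ x y {q} → x ≈ᴿ y → x <q q → y <q q
<q-resp-≈ᴿ x y x≈y x<q@(k , _) =
  <ˢ-const-resp-⊑ {seq x} x<q (⊑-trans (≈ˢ⇒⊒ {seq x} x≈y) (⊑-+ᶜ {seq x} (ε-nonneg (suc k))))

const-<q : ∀ {p q} → p < q → constᴿ p <q q
const-<q {p} {q} p<q =
  let k , εk≤q-p = ε-archimedean (subst (_< q - p) (ℚₚ.+-inverseʳ p) (ℚₚ.+-monoˡ-< (- p) p<q))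
  in k , always λ _ → ≤-rearrange (solve 3 (λ p q e → p :+ e :+ (q :- p) := q :+ e) refl p q (ε k)) εk≤q-p

-- Markov's principle

markov-dec : MarkovPrinciple → {P : ℕ → Set} → (∀ n → Dec (P n)) → ¬ ¬ ∃ P → ∃ P
markov-dec mp {P} P? ¬¬∃P =
  let n , isYes≡true = mp (isYes ∘ P?) λ ¬∃isYes → ¬¬∃P λ (n , p) →
                         ¬∃isYes (n , Equivalence.to T-≡ (fromWitness {a? = P? n} p))
  in n , toWitness {a? = P? n} (Equivalence.from T-≡ isYes≡true)

-- A decidable test which implies x < q, and holds for all large j when x < q.
ApproxBelow : CRN → ℚ → ℕ → Set
ApproxBelow x q j = seq x (modulus x (suc j)) + ε j ≤ q

approxBelow⇒<q : ∀ x {q} j → ApproxBelow x q j → x <q q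
approxBelow⇒<q x {q} j approx = +ε⊑⇒<ˢ {seq x} {const q} {suc j} (begin
  seq x +ᶜ ε (suc j)                                   ⊑⟨ ⊑-shift _ (proj₁ (cauchy-⊑ x ℕₚ.≤-refl)) ⟩
  const (seq x (modulus x (suc j)) + ε (suc j) + ε (suc j))
      ⊑⟨ const-⊑ (ℚₚ.≤-trans (ℚₚ.≤-reflexive (p+ε′+ε′≡p+ε (seq x (modulus x (suc j))) j)) approx) ⟩
  const q                                              ∎)
  where open ⊑-Reasoning

<q⇒approxBelow : ∀ x {q} → x <q q → ∃ λ K → ∀ j → K ℕ.≤ j → ApproxBelow x q j
<q⇒approxBelow x {q} (k , N , x+ε≤q) = suc k , approx
  where
  approx : ∀ j → suc k ℕ.≤ j → ApproxBelow x q j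
  approx j k<j =
    let n , xM≤xn+ε , xn+ε≤q = eventually-witness (eventually-zipWith _,_ close (N , x+ε≤q))
    in begin
      xM + ε j                      ≤⟨ ℚₚ.+-monoˡ-≤ (ε j) xM≤xn+ε ⟩
      seq x n + ε (suc j) + ε j     ≡⟨ ℚₚ.+-assoc (seq x n) _ _ ⟩
      seq x n + (ε (suc j) + ε j)   ≤⟨ ℚₚ.+-monoʳ-≤ (seq x n) (ε-suc+ε≤ε k<j) ⟩
      seq x n + ε k                 ≤⟨ xn+ε≤q ⟩
      q                             ∎
    where
    open ℚₚ.≤-Reasoning
    xM = seq x (modulus x (suc j))
    close : Eventually (λ n → xM ≤ seq x n + ε (suc j))
    close = modulus x (suc j) , λ n M≤n → ∣p-q∣≤r⇒q≤p+r (seq x n) xM (cauchy x (suc j) n _ M≤n ℕₚ.≤-refl)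

markov-<q : MarkovPrinciple → ∀ x {q : ℕ → ℚ} → (∀ {m n} → m ℕ.≤ n → q m ≤ q n) →
            ¬ ¬ (∃ λ n → x <q q n) → ∃ λ n → x <q q n
markov-<q mp x {q} q-mono ¬¬x<q =
  let j , approx = markov-dec mp (λ j → _ ℚₚ.≤? q j) λ ¬approx → ¬¬x<q λ (n , x<qn) → ¬approx (approx-at n x<qn)
  in j , approxBelow⇒<q x j approx
  where
  approx-at : ∀ n → x <q q n → ∃ λ j → ApproxBelow x (q j) j
  approx-at n x<qn =
    let K , approx = <q⇒approxBelow x x<qn
    in n ⊔ K , ℚₚ.≤-trans (approx (n ⊔ K) (ℕₚ.m≤n⊔m n K)) (q-mono (ℕₚ.m≤m⊔n n K))

-- The Specker sets

module IntervalProperties (a b : CRN) where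
  open Interval a b

  open⇒pseudoOpen : ∀ {S} → IsOpen S → IsPseudoOpen S
  open⇒pseudoOpen (G , ball⊆S) s s∈S no-ball = no-ball (G s s∈S , ball⊆S s s∈S)

module SpeckerSetsProperties (a b : CRN) (s : ℕ → ℚ) (specker : IsSpecker a b s) where
  open Interval a b
  open SpeckerSets a b s
  open IntervalProperties a b

  s-increasing : ∀ n → s n < s (suc n)
  s-increasing = proj₁ specker

  s-bounded : ∀ n → (a ≤q s n) × (s n q≤ b)
  s-bounded = proj₁ (proj₂ specker)

  s-divergent : ¬ (Σ CRN λ x → RatConvergesTo s x)
  s-divergent = proj₂ (proj₂ specker)

  s-mono : ∀ {m n} → m ℕ.≤ n → s m ≤ s n
  s-mono m≤n = mono′ (ℕₚ.≤⇒≤′ m≤n)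
    where
    mono′ : ∀ {m n} → m ℕ.≤′ n → s m ≤ s n
    mono′ ℕ.≤′-refl            = ℚₚ.≤-refl
    mono′ (ℕ.≤′-step {n} m≤′n) = ℚₚ.≤-trans (mono′ m≤′n) (ℚₚ.<⇒≤ (s-increasing n))

  a≤pt : ∀ x → a ≤ᴿ pt x
  a≤pt x = proj₁ (proj₂ x)

  pt≤b : ∀ x → pt x ≤ᴿ b
  pt≤b x = proj₂ (proj₂ x)

  A-nonempty : ∃ A
  A-nonempty = (constᴿ (s 0) , s-bounded 0) , 1 , proj₁ (s-bounded 0) , const-<q (s-increasing 0)

  B-nonempty : ∃ B
  B-nonempty = (b , ≤ᴿ-trans a (constᴿ (s 0)) b (proj₁ (s-bounded 0)) (proj₂ (s-bounded 0)) , ≤ᴿ-refl b) ,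
               λ n → proj₂ (s-bounded n) , ≤ᴿ-refl b

  A∩B-empty : ∀ x → ¬ (A x × B x)
  A∩B-empty x ((n , _ , x<sn) , x∈B) = proj₁ (x∈B n) x<sn

  A-suitable : IsSuitable A
  A-suitable x y x≈y (n , _ , x<sn) = n , a≤pt y , <q-resp-≈ᴿ (pt x) (pt y) x≈y x<sn

  B-suitable : IsSuitable B
  B-suitable x y x≈y x∈B n = (λ y<sn → proj₁ (x∈B n) (<q-resp-≈ᴿ (pt y) (pt x) (≈ᴿ-sym (pt x) (pt y) x≈y) y<sn)) ,
                             pt≤b y

  ¬A⇒B : ∀ x → ¬ A x → B x
  ¬A⇒B x x∉A n = (λ x<sn → x∉A (n , a≤pt x , x<sn)) , pt≤b x

  ¬B⇒A : MarkovPrinciple → ∀ x → ¬ B x → A x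
  ¬B⇒A mp x x∉B =
    let n , x<sn = markov-<q mp (pt x) s-mono λ ¬∃ → x∉B λ n → (λ x<sn → ¬∃ (n , x<sn)) , pt≤b x
    in n , a≤pt x , x<sn

  A-open : IsOpen A
  A-open = radius , ball⊆A
    where
    radius : ∀ x → A x → ℕ
    radius x (n , _ , k , _) = suc k
    ball⊆A : ∀ x x∈A → Ball x (radius x x∈A) ⊆ A
    ball⊆A x (n , _ , x<sn@(k , _)) y x~y =
      n , a≤pt y , <ˢ-const-resp-⊑ {seq (pt x)} x<sn
                     (proj₂ (dist⊑⇒⊑ {seq (pt x)} (<ˢ⇒⊑ {dist (seq (pt x)) (seq (pt y))} x~y)))

  B-closed : IsClosed B
  B-closed = A , A-open , λ x → (λ x∈B x∈A → A∩B-empty x (x∈A , x∈B)) , ¬A⇒B x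

  A-sequentiallyClosed : MarkovPrinciple → IsSequentiallyClosed A
  A-sequentiallyClosed mp f x f∈A (M , f→x) =
    ¬B⇒A mp x λ x∈B → s-divergent (pt x , (λ k → index (M k)) , s→x x∈B)
    where
    index : ℕ → ℕ
    index n = proj₁ (f∈A n)
    s→x : B x → ∀ k p → index (M k) ℕ.≤ p → dist (const (s p)) (seq (pt x)) ≤ˢ const (ε k)
    s→x x∈B k p index≤p = dist-const≤ˢ (pt x) (ε-nonneg k) (proj₁ (x∈B p)) (begin
      seq (pt x)                          ⊑⟨ proj₂ (dist≤ˢ⇒⊑ (pt (f n)) (pt x) (f→x k n ℕₚ.≤-refl)) ⟩
      seq (pt (f n)) +ᶜ ε k               ⊑⟨ ⊑-shift (ε k) (<ˢ⇒⊑ {seq (pt (f n))} (proj₂ (proj₂ (f∈A n)))) ⟩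
      const (s (index n)) +ᶜ ε k          ⊑⟨ ⊑-shift (ε k) (const-⊑ (s-mono index≤p)) ⟩
      const (s p) +ᶜ ε k                  ∎)
      where
      open ⊑-Reasoning
      n = M k

  B-sequentiallyClosed : IsSequentiallyClosed B
  B-sequentiallyClosed f x f∈B (M , f→x) p = ⊑⇒≤ˢ {const (s p)} {seq (pt x)} (⊑-+ε⇒⊑ sp⊑x+ε) , pt≤b x
    where
    sp⊑x+ε : ∀ k → const (s p) ⊑ seq (pt x) +ᶜ ε k
    sp⊑x+ε k = ⊑-trans (≤ᴿ⇒⊑ (constᴿ (s p)) (pt (f (M k))) (proj₁ (f∈B (M k) p)))
                       (proj₁ (dist≤ˢ⇒⊑ (pt (f (M k))) (pt x) (f→x k (M k) ℕₚ.≤-refl)))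

  B-pseudoOpen : MarkovPrinciple → IsPseudoOpen B
  B-pseudoOpen mp x x∈B no-ball = s-divergent (pt x , (λ k → proj₁ (nearby k)) , s→x)
    where
    -- Markov's principle finds, for each k, some s m at most about ε k below x.
    X = seq (pt x)
    X̂ : ℕ → ℚ
    X̂ k = X (modulus (pt x) (2 ℕ.+ k))
    Nearby : ℕ → ℕ → Set
    Nearby k m = X̂ k < s m + ε (suc k)

    ball⊆B : ∀ k → (∀ m → ¬ Nearby k m) → Ball x (2 ℕ.+ k) ⊆ B
    ball⊆B k far y x~y m = ⊑⇒≤ˢ {const (s m)} {seq (pt y)}
      (⊑-cancel d (⊑-cancel {const (s m) +ᶜ d} {seq (pt y) +ᶜ d} d (begin
      const (s m) +ᶜ d +ᶜ d   ⊑⟨ const-⊑ (ℚₚ.≤-trans (ℚₚ.≤-reflexive (p+ε′+ε′≡p+ε (s m) (suc k)))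
                                                    (ℚₚ.≮⇒≥ (far m))) ⟩
      const (X̂ k)             ⊑⟨ proj₂ (cauchy-⊑ (pt x) ℕₚ.≤-refl) ⟩
      X +ᶜ d                  ⊑⟨ ⊑-shift d (proj₁ (dist⊑⇒⊑ {X} (<ˢ⇒⊑ {dist X (seq (pt y))} x~y))) ⟩
      seq (pt y) +ᶜ d +ᶜ d    ∎))) , pt≤b y
      where
      open ⊑-Reasoning
      d = ε (2 ℕ.+ k)

    nearby : ∀ k → ∃ (Nearby k)
    nearby k = markov-dec mp (λ m → X̂ k ℚₚ.<? s m + ε (suc k))
                 λ ¬∃ → no-ball (2 ℕ.+ k , ball⊆B k λ m near → ¬∃ (m , near))

    X̂+ε≤sp+ε : ∀ k p → proj₁ (nearby k) ℕ.≤ p → X̂ k + ε (2 ℕ.+ k) ≤ s p + ε k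
    X̂+ε≤sp+ε k p m≤p = begin
      X̂ k + ε (2 ℕ.+ k)                  ≤⟨ ℚₚ.+-monoˡ-≤ _ (ℚₚ.<⇒≤ (proj₂ (nearby k))) ⟩
      s m + ε (suc k) + ε (2 ℕ.+ k)      ≡⟨ solve 3 (λ x a b → x :+ a :+ b := x :+ (b :+ a)) refl (s m) _ _ ⟩
      s m + (ε (2 ℕ.+ k) + ε (suc k))    ≤⟨ ℚₚ.+-mono-≤ (s-mono m≤p) (ε-suc+ε≤ε (ℕₚ.n<1+n k)) ⟩
      s p + ε k                          ∎
      where
      open ℚₚ.≤-Reasoning
      m = proj₁ (nearby k)

    s→x : ∀ k p → proj₁ (nearby k) ℕ.≤ p → dist (const (s p)) X ≤ˢ const (ε k)
    s→x k p m≤p = dist-const≤ˢ (pt x) (ε-nonneg k) (proj₁ (x∈B p)) (begin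
      X                           ⊑⟨ proj₁ (cauchy-⊑ (pt x) ℕₚ.≤-refl) ⟩
      const (X̂ k + ε (2 ℕ.+ k))   ⊑⟨ const-⊑ (X̂+ε≤sp+ε k p m≤p) ⟩
      const (s p + ε k)           ∎)
      where open ⊑-Reasoning

theorem14 : MarkovPrinciple →
    (a b : CRN) (s : ℕ → ℚ) → IsSpecker a b s →
    let open Interval a b
        open SpeckerSets a b s
    in WeaklySeparate A B ×
       (IsOpen A × IsPseudoOpen A × IsSequentiallyClosed A) ×
       (IsClosed B × IsPseudoOpen B × IsSequentiallyClosed B)
theorem14 mp a b s specker =
  (A-nonempty , B-nonempty , A∩B-empty , A-suitable , B-suitable , (λ x → ¬A⇒B x , ¬B⇒A mp x)) ,
  (A-open , open⇒pseudoOpen A-open , A-sequentiallyClosed mp) ,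
  (B-closed , B-pseudoOpen mp , B-sequentiallyClosed)
  where
  open SpeckerSetsProperties a b s specker
  open IntervalProperties a b
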